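{- Let $m\ge1$, $n\ge0$, let $\mathfrak{s}$ be an $m$-star and $\mathfrak{c}$ an $n$-chain. The number of proper mergings of $\mathfrak{s}$ and $\mathfrak{c}$ of the form $(\emptyset,T)$ is $\sum_{k=1}^{n+1}k^m$.
   Context: For posets $(P,\le_P)$, $(Q,\le_Q)$ on disjoint ground sets and $R\subseteq P\times Q$, $T\subseteq Q\times P$, define $\le_{R,T}$ on $P\cup Q$ by: $x\le_{R,T}y$ iff $x\le_P y$, or $x\le_Q y$, or $(x,y)\in R$, or $(x,y)\in T$. $(R,T)$ is a merging if $\le_{R,T}$ is reflexive and transitive, and a proper merging if moreover $R\cap T^{ -1}=\emptyset$. Here $P=S=\{s_0,\dots,s_m\}$ is the $m$-star ($s\le s'$ iff $s=s'$ or $s=s_0$) and $Q=C=\{c_1,\dots,c_n\}$ is the $n$-chain ($c_i\le c_j$ iff $i\le j$), so $R\subseteq S\times C$ and $T\subseteq C\times S$. -}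

module Defs where

open import Data.Nat using (ℕ; zero; suc; _^_)
open import Data.Fin using (Fin; zero; suc) renaming (_≤_ to _≤ᶠ_)
open import Data.Bool using (Bool; true)
open import Data.Vec using (Vec; lookup)
open import Data.Sum using (_⊎_; inj₁; inj₂)
open import Data.Product using (_×_)
open import Data.List using (List; map; upTo)
open import Data.Nat.ListAction using (sum)
open import Relation.Binary.PropositionalEquality using (_≡_)
open import Relation.Nullary using (¬_)

-- The m-star S = {s_0,…,s_m}: ground set Fin (suc m), s_0 = zero.
-- s ≤ s' iff s = s' or s = s_0.
_≤S_ : {m : ℕ} → Fin (suc m) → Fin (suc m) → Set
s ≤S s' = (s ≡ s') ⊎ (s ≡ zero)

-- The n-chain C = {c_1,…,c_n}: ground set Fin n (c_{i+1} ↔ i), usual order.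
_≤C_ : {n : ℕ} → Fin n → Fin n → Set
c ≤C c' = c ≤ᶠ c'

RelSC : ℕ → ℕ → Set
RelSC m n = Vec (Vec Bool n) (suc m)

RelCS : ℕ → ℕ → Set
RelCS m n = Vec (Vec Bool (suc m)) n

inR : {m n : ℕ} → RelSC m n → Fin (suc m) → Fin n → Set
inR R s c = lookup (lookup R s) c ≡ true

inT : {m n : ℕ} → RelCS m n → Fin n → Fin (suc m) → Set
inT T c s = lookup (lookup T c) s ≡ true

Elt : ℕ → ℕ → Set
Elt m n = Fin (suc m) ⊎ Fin n

-- x ≤_{R,T} y  iff  x ≤_S y or x ≤_C y or (x,y) ∈ R or (x,y) ∈ T
-- (on a disjoint union, exactly one of the four clauses is applicable).
_⊢_≤RT_ : {m n : ℕ} → RelSC m n × RelCS m n → Elt m n → Elt m n → Set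
_⊢_≤RT_ (R Data.Product., T) (inj₁ s) (inj₁ s') = s ≤S s'
_⊢_≤RT_ (R Data.Product., T) (inj₂ c) (inj₂ c') = c ≤C c'
_⊢_≤RT_ (R Data.Product., T) (inj₁ s) (inj₂ c) = inR R s c
_⊢_≤RT_ (R Data.Product., T) (inj₂ c) (inj₁ s) = inT T c s

IsMerging : {m n : ℕ} → RelSC m n → RelCS m n → Set
IsMerging {m} {n} R T =
  ((x : Elt m n) → (R Data.Product., T) ⊢ x ≤RT x) ×
  ((x y z : Elt m n) → (R Data.Product., T) ⊢ x ≤RT y →
     (R Data.Product., T) ⊢ y ≤RT z → (R Data.Product., T) ⊢ x ≤RT z)

IsProperMerging : {m n : ℕ} → RelSC m n → RelCS m n → Set
IsProperMerging {m} {n} R T =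
  IsMerging R T × ((s : Fin (suc m)) (c : Fin n) → ¬ (inR R s c × inT T c s))

emptySC : {m n : ℕ} → RelSC m n
emptySC = Data.Vec.replicate _ (Data.Vec.replicate _ Data.Bool.false)

powerSum : ℕ → ℕ → ℕ
powerSum m n = sum (map (λ k → suc k ^ m) (upTo (suc n)))

module Submission where

-- Store T ⊆ C × S as the vector of its rows T(c) ⊆ S.  With R = ∅ the only
-- non-vacuous instances of transitivity say that (∅,T) is a proper merging
-- iff T is "admissible":
--   (i)  the rows descend along the chain: c ≤ c' implies T(c') ⊆ T(c);
--   (ii) a row containing the centre s₀ is the whole star.
-- Admissible T are enumerated by recursion on n, splitting on the row T(c₁):
--   * s₀ ∈ T(c₁): then T(c₁) = S and the other rows form an arbitrary
--     admissible relation for the (n-1)-chain;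
--   * s₀ ∉ T(c₁): then s₀ lies in no row and the remaining m columns are
--     arbitrary down-sets of the n-chain, giving (n+1)^m relations.
-- So the count a(n) satisfies a(0) = 1 and a(n+1) = a(n) + (n+2)^m, whence
-- a(n) = Σ_{k=1}^{n+1} k^m.

open import Defs
open import Data.Nat using (ℕ; _≤_; zero; suc; _+_; _*_; _^_; z≤n; s≤s)
open import Data.Nat.Properties using (+-identityʳ; ^-zeroˡ)
open import Data.Nat.ListAction using (sum)
open import Data.Nat.ListAction.Properties using (sum-++)
open import Data.Fin using (Fin; zero; suc) renaming (_≤_ to _≤ᶠ_)
open import Data.Fin.Properties using (≤-refl; ≤-trans)
open import Data.Bool using (Bool; true; false)
open import Data.List using (List; []; _∷_; [_]; _++_; map; length; upTo; cartesianProductWith)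
open import Data.List.Properties using (length-map; length-++; map-++; upTo-∷ʳ)
open import Data.List.Membership.Propositional using (_∈_)
open import Data.List.Membership.Propositional.Properties
  using (∈-map⁺; ∈-map⁻; ∈-++⁺ˡ; ∈-++⁺ʳ; ∈-++⁻; ∈-cartesianProductWith⁺; ∈-cartesianProductWith⁻)
open import Data.List.Relation.Unary.Any using (here; there)
open import Data.List.Relation.Unary.Unique.Propositional using (Unique)
import Data.List.Relation.Unary.Unique.Propositional.Properties as Unique
import Data.List.Relation.Unary.All as ListAll
import Data.List.Relation.Unary.AllPairs as ListAllPairs
open import Data.Vec using (Vec; lookup; replicate; zipWith; head; tail)
  renaming ([] to []ᵛ; _∷_ to _∷ᵛ_; map to mapᵛ)
open import Data.Vec.Properties using (∷-injective; ∷-injectiveʳ; lookup-replicate)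
open import Data.Vec.Relation.Unary.All as All using (All; []; _∷_)
open import Data.Vec.Relation.Unary.All.Properties using (lookup⁺; lookup⁻)
open import Data.Vec.Relation.Unary.AllPairs using (AllPairs; []; _∷_)
open import Data.Product using (Σ; _×_; _,_; proj₂; ∃-syntax)
open import Data.Sum using (inj₁; inj₂) renaming (map to map-⊎)
open import Data.Empty using (⊥; ⊥-elim)
open import Function.Base using (case_of_)
open import Function.Bundles using (_⇔_; mk⇔; Equivalence)
import Function.Properties.Equivalence as ⇔
open import Relation.Binary.Core using (Rel)
open import Relation.Binary.Definitions using (Reflexive)
open import Relation.Binary.PropositionalEquality
  using (_≡_; refl; sym; trans; cong; cong₂; subst; module ≡-Reasoning)
open import Relation.Unary using (_∪_)
open import Level using (0ℓ)

open Equivalence using (to; from)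

Enumerates : {A : Set} → (A → Set) → List A → Set
Enumerates {A} P xs = Unique xs × ((x : A) → x ∈ xs ⇔ P x)

Image : {A B : Set} → (A → B) → (A → Set) → B → Set
Image f P y = ∃[ x ] P x × f x ≡ y

Image₂ : {A B C : Set} → (A → B → C) → (A → Set) → (B → Set) → C → Set
Image₂ f P Q z = ∃[ x ] ∃[ y ] P x × Q y × f x y ≡ z

module _ {A : Set} where

  enum-cong : {P Q : A → Set} {xs : List A} →
              ((x : A) → P x ⇔ Q x) → Enumerates P xs → Enumerates Q xs
  enum-cong P⇔Q (unique , member) = unique , λ x → ⇔.trans (member x) (P⇔Q x)

  enum-[_] : (a : A) → Enumerates (_≡ a) [ a ]
  enum-[ a ] = ListAll.[] ListAllPairs.∷ ListAllPairs.[] ,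
               λ x → mk⇔ (λ { (here x≡a) → x≡a ; (there ()) }) here

  enum-singleton : {P : A → Set} {a : A} → ((x : A) → x ≡ a) → P a → Enumerates P [ a ]
  enum-singleton {P} {a} only-a Pa =
    enum-cong (λ x → mk⇔ (λ x≡a → subst P (sym x≡a) Pa) (λ _ → only-a x)) enum-[ a ]

  enum-++ : {P Q : A → Set} {xs ys : List A} → ((x : A) → P x → Q x → ⊥) →
            Enumerates P xs → Enumerates Q ys → Enumerates (P ∪ Q) (xs ++ ys)
  enum-++ {xs = xs} disjoint (uxs , mxs) (uys , mys) =
    Unique.++⁺ uxs uys (λ { {x} (x∈xs , x∈ys) → disjoint x (to (mxs x) x∈xs) (to (mys x) x∈ys) }) ,
    λ x → mk⇔ (λ x∈ → map-⊎ (to (mxs x)) (to (mys x)) (∈-++⁻ xs x∈))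
              (λ { (inj₁ Px) → ∈-++⁺ˡ (from (mxs x) Px) ; (inj₂ Qx) → ∈-++⁺ʳ xs (from (mys x) Qx) })

module _ {A B : Set} where

  enum-map : {P : A → Set} {xs : List A} (f : A → B) → (∀ {x y} → f x ≡ f y → x ≡ y) →
             Enumerates P xs → Enumerates (Image f P) (map f xs)
  enum-map f f-injective (unique , member) =
    Unique.map⁺ f-injective unique ,
    λ y → mk⇔ (λ y∈ → let x , x∈ , y≡fx = ∈-map⁻ f y∈ in x , to (member x) x∈ , sym y≡fx)
              (λ { (x , Px , refl) → ∈-map⁺ f (from (member x) Px) })

  module _ {C : Set} where

    enum-product : {P : A → Set} {Q : B → Set} {xs : List A} {ys : List B} (f : A → B → C) →
                   (∀ {a a' b b'} → f a b ≡ f a' b' → a ≡ a' × b ≡ b') →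
                   Enumerates P xs → Enumerates Q ys →
                   Enumerates (Image₂ f P Q) (cartesianProductWith f xs ys)
    enum-product {xs = xs} {ys} f f-injective (uxs , mxs) (uys , mys) =
      Unique.cartesianProductWith⁺ f f-injective uxs uys ,
      λ z → mk⇔ (λ z∈ → let a , b , a∈ , b∈ , z≡fab = ∈-cartesianProductWith⁻ f xs ys z∈
                        in a , b , to (mxs a) a∈ , to (mys b) b∈ , sym z≡fab)
                (λ { (a , b , Pa , Qb , refl) → ∈-cartesianProductWith⁺ f (from (mxs a) Pa) (from (mys b) Qb) })

    length-cartesianProductWith : (f : A → B → C) (xs : List A) (ys : List B) →
                                  length (cartesianProductWith f xs ys) ≡ length xs * length ys
    length-cartesianProductWith f [] ys = refl
    length-cartesianProductWith f (x ∷ xs) ys =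
      trans (length-++ (map (f x) ys))
            (cong₂ _+_ (length-map (f x) ys) (length-cartesianProductWith f xs ys))

module _ {A : Set} {R : Rel A 0ℓ} where

  allPairs⇒monotone : Reflexive R → ∀ {k} {xs : Vec A k} → AllPairs R xs →
                      ∀ {i j} → i ≤ᶠ j → R (lookup xs i) (lookup xs j)
  allPairs⇒monotone R-refl (_ ∷ _)    {zero}  {zero}  _ = R-refl
  allPairs⇒monotone R-refl (Rx ∷ _)   {zero}  {suc j} _ = lookup⁺ Rx j
  allPairs⇒monotone R-refl (_ ∷ Rxs)  {suc i} {suc j} (s≤s i≤j) =
    allPairs⇒monotone R-refl Rxs i≤j

  monotone⇒allPairs : ∀ {k} {xs : Vec A k} →
                      (∀ {i j} → i ≤ᶠ j → R (lookup xs i) (lookup xs j)) → AllPairs R xs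
  monotone⇒allPairs {xs = []ᵛ}     mono = []
  monotone⇒allPairs {xs = x ∷ᵛ xs} mono =
    lookup⁻ (λ j → mono {zero} {suc j} z≤n) ∷ monotone⇒allPairs (λ i≤j → mono (s≤s i≤j))

  replicate-allPairs : ∀ {k x} → R x x → AllPairs R (replicate k x)
  replicate-allPairs {zero}  Rxx = []
  replicate-allPairs {suc k} {x} Rxx = all-related k ∷ replicate-allPairs Rxx
    where
    all-related : ∀ k → All (R x) (replicate k x)
    all-related zero    = []
    all-related (suc k) = Rxx ∷ all-related k

module _ {A B C : Set} {f : A → B → C} {R : Rel C 0ℓ} {S : Rel A 0ℓ} {T : Rel B 0ℓ} where

  allPairs-zipWith⁺ : (∀ {a a' b b'} → S a a' → T b b' → R (f a b) (f a' b')) →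
                      ∀ {k} {v : Vec A k} {M : Vec B k} →
                      AllPairs S v → AllPairs T M → AllPairs R (zipWith f v M)
  allPairs-zipWith⁺ combine {v = []ᵛ}    {[]ᵛ}    []         []         = []
  allPairs-zipWith⁺ combine {v = _ ∷ᵛ _} {_ ∷ᵛ _} (Sa ∷ Sv) (Tb ∷ TM) =
    all-zipWith Sa Tb ∷ allPairs-zipWith⁺ combine Sv TM
    where
    all-zipWith : ∀ {k a b} {v : Vec A k} {M : Vec B k} →
                  All (S a) v → All (T b) M → All (R (f a b)) (zipWith f v M)
    all-zipWith []          []          = []
    all-zipWith (Saa' ∷ Sa) (Tbb' ∷ Tb) = combine Saa' Tbb' ∷ all-zipWith Sa Tb

  allPairs-zipWith⁻ : (∀ {a a' b b'} → R (f a b) (f a' b') → S a a' × T b b') →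
                      ∀ {k} {v : Vec A k} {M : Vec B k} →
                      AllPairs R (zipWith f v M) → AllPairs S v × AllPairs T M
  allPairs-zipWith⁻ split {v = []ᵛ}    {[]ᵛ}    []         = [] , []
  allPairs-zipWith⁻ split {v = _ ∷ᵛ _} {_ ∷ᵛ _} (Rr ∷ Rrs) =
    let Sa , Tb = all-zipWith Rr ; Sv , TM = allPairs-zipWith⁻ split Rrs
    in Sa ∷ Sv , Tb ∷ TM
    where
    all-zipWith : ∀ {k a b} {v : Vec A k} {M : Vec B k} →
                  All (R (f a b)) (zipWith f v M) → All (S a) v × All (T b) M
    all-zipWith {v = []ᵛ}    {[]ᵛ}    []         = [] , []
    all-zipWith {v = _ ∷ᵛ _} {_ ∷ᵛ _} (Rab ∷ Rs) =
      let Saa' , Tbb' = split Rab ; Sa , Tb = all-zipWith Rs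
      in Saa' ∷ Sa , Tbb' ∷ Tb

_≥ᵇ_ : Bool → Bool → Set
b ≥ᵇ b' = b' ≡ true → b ≡ true

_⊇_ : ∀ {w} → Vec Bool w → Vec Bool w → Set
r ⊇ r' = ∀ s → lookup r' s ≡ true → lookup r s ≡ true

-- The indicator vector of a down-set of the k-chain: true…true false…false.
DownSet : ∀ {k} → Vec Bool k → Set
DownSet = AllPairs _≥ᵇ_

-- A k × w Boolean matrix whose rows decrease; equivalently, each column is a down-set.
Descending : ∀ {k w} → Vec (Vec Bool w) k → Set
Descending = AllPairs _⊇_

∷-⊇⁺ : ∀ {w b b'} {r r' : Vec Bool w} → b ≥ᵇ b' → r ⊇ r' → (b ∷ᵛ r) ⊇ (b' ∷ᵛ r')
∷-⊇⁺ b≥b' r⊇r' zero    = b≥b'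
∷-⊇⁺ b≥b' r⊇r' (suc s) = r⊇r' s

∷-⊇⁻ : ∀ {w b b'} {r r' : Vec Bool w} → (b ∷ᵛ r) ⊇ (b' ∷ᵛ r') → b ≥ᵇ b' × r ⊇ r'
∷-⊇⁻ br⊇b'r' = br⊇b'r' zero , λ s → br⊇b'r' (suc s)

downSet-without-minimum : ∀ {k} {v : Vec Bool k} → DownSet (false ∷ᵛ v) → v ≡ replicate k false
downSet-without-minimum (below ∷ _) = all-false below
  where
  all-false : ∀ {k} {v : Vec Bool k} → All (false ≥ᵇ_) v → v ≡ replicate k false
  all-false {v = []ᵛ}         []          = refl
  all-false {v = false ∷ᵛ v} (_ ∷ rest)  = cong (false ∷ᵛ_) (all-false rest)
  all-false {v = true ∷ᵛ v}  (f≥t ∷ _) with () ← f≥t refl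

downSet-split : ∀ {k} (v : Vec Bool (suc k)) →
                DownSet v ⇔ ((_≡ replicate (suc k) false) ∪ Image (true ∷ᵛ_) DownSet) v
downSet-split v = mk⇔ cases (λ { (inj₁ refl) → replicate-allPairs (λ f≡t → f≡t)
                               ; (inj₂ (u , dsu , refl)) → All.universal (λ _ _ → refl) u ∷ dsu })
  where
  cases : ∀ {k} {v : Vec Bool (suc k)} → DownSet v →
          ((_≡ replicate (suc k) false) ∪ Image (true ∷ᵛ_) DownSet) v
  cases {v = false ∷ᵛ u} ds        = inj₁ (cong (false ∷ᵛ_) (downSet-without-minimum ds))
  cases {v = true ∷ᵛ u}  (_ ∷ dsu) = inj₂ (u , dsu , refl)

downSets : ∀ k → List (Vec Bool k)
downSets zero    = [ []ᵛ ]
downSets (suc k) = [ replicate (suc k) false ] ++ map (true ∷ᵛ_) (downSets k)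

enum-downSets : ∀ k → Enumerates DownSet (downSets k)
enum-downSets zero    = enum-singleton (λ { []ᵛ → refl }) []
enum-downSets (suc k) =
  enum-cong (λ v → ⇔.sym (downSet-split v))
    (enum-++ (λ { _ refl (_ , _ , ()) })
      enum-[ replicate (suc k) false ]
      (enum-map (true ∷ᵛ_) ∷-injectiveʳ (enum-downSets k)))

length-downSets : ∀ k → length (downSets k) ≡ suc k
length-downSets zero    = refl
length-downSets (suc k) = cong suc (trans (length-map (true ∷ᵛ_) (downSets k)) (length-downSets k))

addColumn : ∀ {k w} → Vec Bool k → Vec (Vec Bool w) k → Vec (Vec Bool (suc w)) k
addColumn = zipWith _∷ᵛ_

addColumn-injective : ∀ {k w} {v v' : Vec Bool k} {M M' : Vec (Vec Bool w) k} →
                      addColumn v M ≡ addColumn v' M' → v ≡ v' × M ≡ M'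
addColumn-injective {v = []ᵛ} {[]ᵛ} {[]ᵛ} {[]ᵛ} refl = refl , refl
addColumn-injective {v = _ ∷ᵛ _} {_ ∷ᵛ _} {_ ∷ᵛ _} {_ ∷ᵛ _} eq
  with first-row , other-rows ← ∷-injective eq
  with refl , refl ← ∷-injective first-row
  with refl , refl ← addColumn-injective other-rows = refl , refl

addColumn-head-tail : ∀ {k w} (M : Vec (Vec Bool (suc w)) k) → addColumn (mapᵛ head M) (mapᵛ tail M) ≡ M
addColumn-head-tail []ᵛ              = refl
addColumn-head-tail ((b ∷ᵛ r) ∷ᵛ M) = cong ((b ∷ᵛ r) ∷ᵛ_) (addColumn-head-tail M)

descending-split : ∀ {k w} (M : Vec (Vec Bool (suc w)) k) →
                   Descending M ⇔ Image₂ addColumn DownSet Descending M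
descending-split M = mk⇔
  (λ desc → let dsv , descN = allPairs-zipWith⁻ ∷-⊇⁻ (subst Descending (sym (addColumn-head-tail M)) desc)
            in mapᵛ head M , mapᵛ tail M , dsv , descN , addColumn-head-tail M)
  (λ { (v , N , dsv , descN , refl) → allPairs-zipWith⁺ ∷-⊇⁺ dsv descN })

descendingMatrices : ∀ k w → List (Vec (Vec Bool w) k)
descendingMatrices k zero    = [ replicate k []ᵛ ]
descendingMatrices k (suc w) = cartesianProductWith addColumn (downSets k) (descendingMatrices k w)

enum-descendingMatrices : ∀ k w → Enumerates Descending (descendingMatrices k w)
enum-descendingMatrices k zero    = enum-singleton no-columns (replicate-allPairs (λ ()))
  where
  no-columns : ∀ {k} (M : Vec (Vec Bool zero) k) → M ≡ replicate k []ᵛ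
  no-columns []ᵛ          = refl
  no-columns ([]ᵛ ∷ᵛ M) = cong ([]ᵛ ∷ᵛ_) (no-columns M)
enum-descendingMatrices k (suc w) =
  enum-cong (λ M → ⇔.sym (descending-split M))
    (enum-product addColumn addColumn-injective (enum-downSets k) (enum-descendingMatrices k w))

-- There are (k+1)^w of them: one down-set of the k-chain per column.
length-descendingMatrices : ∀ k w → length (descendingMatrices k w) ≡ suc k ^ w
length-descendingMatrices k zero    = refl
length-descendingMatrices k (suc w) =
  trans (length-cartesianProductWith addColumn (downSets k) (descendingMatrices k w))
        (cong₂ _*_ (length-downSets k) (length-descendingMatrices k w))

CentreClosed : ∀ {m} → Vec Bool (suc m) → Set
CentreClosed r = lookup r zero ≡ true → ∀ s → lookup r s ≡ true

Admissible : ∀ {m n} → RelCS m n → Set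
Admissible T = Descending T × All CentreClosed T

emptySC-empty : ∀ {m n} (s : Fin (suc m)) (c : Fin n) → inR (emptySC {m} {n}) s c → ⊥
emptySC-empty {m} {n} s c s∅c = case false≡true of λ ()
  where
  open ≡-Reasoning
  false≡true : false ≡ true
  false≡true = begin
    false                                                 ≡⟨ sym (lookup-replicate c false) ⟩
    lookup (replicate n false) c                          ≡⟨ cong (λ row → lookup row c) (sym (lookup-replicate s _)) ⟩
    lookup (lookup (emptySC {m} {n}) s) c                 ≡⟨ s∅c ⟩
    true                                                  ∎

-- With R = ∅, transitivity of ≤_{∅,T} only has content for the chains
-- c ≤ c' T s (rows descend) and c T s₀ ≤ s (centre-closed rows).
admissible⇒properMerging : ∀ {m n} (T : RelCS m n) → Admissible T → IsProperMerging emptySC T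
admissible⇒properMerging {m} {n} T (desc , centre) =
  (reflexive , transitive) , λ s c (s∅c , _) → emptySC-empty s c s∅c
  where
  rows-descend : ∀ {c c'} → c ≤ᶠ c' → lookup T c ⊇ lookup T c'
  rows-descend = allPairs⇒monotone (λ s p → p) desc

  _⊑_ : Elt m n → Elt m n → Set
  x ⊑ y = (emptySC , T) ⊢ x ≤RT y

  reflexive : ∀ x → x ⊑ x
  reflexive (inj₁ s) = inj₁ refl
  reflexive (inj₂ c) = ≤-refl

  transitive : ∀ x y z → x ⊑ y → y ⊑ z → x ⊑ z
  transitive (inj₁ s) (inj₁ s') (inj₁ s'') (inj₁ refl) s'≤s'' = s'≤s''
  transitive (inj₁ s) (inj₁ s') (inj₁ s'') (inj₂ s≡s₀) _      = inj₂ s≡s₀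
  transitive (inj₁ _) (inj₁ s') (inj₂ c)   _ s'∅c             = ⊥-elim (emptySC-empty s' c s'∅c)
  transitive (inj₁ s) (inj₂ c)  _          s∅c _              = ⊥-elim (emptySC-empty s c s∅c)
  transitive (inj₂ c) (inj₁ s)  (inj₁ s')  cTs (inj₁ refl)    = cTs
  transitive (inj₂ c) (inj₁ s)  (inj₁ s')  cTs₀ (inj₂ refl)   = lookup⁺ centre c cTs₀ s'
  transitive (inj₂ _) (inj₁ s)  (inj₂ c')  _ s∅c'             = ⊥-elim (emptySC-empty s c' s∅c')
  transitive (inj₂ c) (inj₂ c') (inj₁ s)   c≤c' c'Ts          = rows-descend c≤c' s c'Ts
  transitive (inj₂ c) (inj₂ c') (inj₂ c'') c≤c' c'≤c''        = ≤-trans c≤c' c'≤c''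

-- Conversely, both chains are instances of transitivity, so (∅,T) is a
-- proper merging exactly when T is admissible.
properMerging⇔admissible : ∀ {m n} (T : RelCS m n) → IsProperMerging emptySC T ⇔ Admissible T
properMerging⇔admissible T = mk⇔
  (λ ((_ , transitive) , _) →
    monotone⇒allPairs (λ {c} {c'} c≤c' s c'Ts → transitive (inj₂ c) (inj₂ c') (inj₁ s) c≤c' c'Ts) ,
    lookup⁻ (λ c cTs₀ s → transitive (inj₂ c) (inj₁ zero) (inj₁ s) cTs₀ (inj₂ refl)))
  (admissible⇒properMerging T)

full-row : ∀ {w} (r : Vec Bool w) → (∀ s → lookup r s ≡ true) → r ≡ replicate w true
full-row []ᵛ       _    = refl
full-row (b ∷ᵛ r) full = cong₂ _∷ᵛ_ (full zero) (full-row r (λ s → full (suc s)))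

first-column-empty : ∀ {k w} {r : Vec Bool w} {M : Vec (Vec Bool (suc w)) k} →
                     Descending ((false ∷ᵛ r) ∷ᵛ M) →
                     Image (addColumn (replicate (suc k) false)) Descending ((false ∷ᵛ r) ∷ᵛ M)
first-column-empty desc
  with false ∷ᵛ v , r ∷ᵛ N , dsv , descN , refl ← to (descending-split _) desc =
  r ∷ᵛ N , descN , cong (λ u → addColumn (false ∷ᵛ u) (r ∷ᵛ N)) (sym (downSet-without-minimum dsv))

admissible-split : ∀ {m n} (T : RelCS m (suc n)) →
                   Admissible T ⇔ (Image (replicate (suc m) true ∷ᵛ_) Admissible
                                   ∪ Image (addColumn (replicate (suc n) false)) Descending) T
admissible-split T = mk⇔ cases
  (λ { (inj₁ (T' , (desc , centre) , refl)) →
         All.universal (λ r s _ → lookup-replicate s true) _ ∷ desc ,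
         (λ _ s → lookup-replicate s true) ∷ centre
     ; (inj₂ (N , descN , refl)) →
         allPairs-zipWith⁺ ∷-⊇⁺ (replicate-allPairs (λ f≡t → f≡t)) descN , centre-free N })
  where
  cases : ∀ {m n} {T : RelCS m (suc n)} → Admissible T →
          (Image (replicate (suc m) true ∷ᵛ_) Admissible ∪ Image (addColumn (replicate (suc n) false)) Descending) T
  cases {T = (true ∷ᵛ r) ∷ᵛ T'}  (_ ∷ desc , centreClosed ∷ centre) =
    inj₁ (T' , (desc , centre) , cong (_∷ᵛ T') (sym (full-row _ (centreClosed refl))))
  cases {T = (false ∷ᵛ r) ∷ᵛ T'} (desc , _) = inj₂ (first-column-empty desc)

  centre-free : ∀ {k w} (N : Vec (Vec Bool w) k) → All CentreClosed (addColumn (replicate k false) N)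
  centre-free []ᵛ       = []
  centre-free (_ ∷ᵛ N) = (λ ()) ∷ centre-free N

admissibles : ∀ m n → List (RelCS m n)
admissibles m zero    = [ []ᵛ ]
admissibles m (suc n) = map (replicate (suc m) true ∷ᵛ_) (admissibles m n)
                     ++ map (addColumn (replicate (suc n) false)) (descendingMatrices (suc n) m)

enum-admissibles : ∀ m n → Enumerates Admissible (admissibles m n)
enum-admissibles m zero    = enum-singleton (λ { []ᵛ → refl }) ([] , [])
enum-admissibles m (suc n) =
  enum-cong (λ T → ⇔.sym (admissible-split T))
    (enum-++ (λ { _ (_ , _ , refl) (_ ∷ᵛ _ , _ , ()) })
      (enum-map _ ∷-injectiveʳ (enum-admissibles m n))
      (enum-map _ (λ eq → proj₂ (addColumn-injective eq)) (enum-descendingMatrices (suc n) m)))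

powerSum-suc : ∀ m n → powerSum m (suc n) ≡ powerSum m n + suc (suc n) ^ m
powerSum-suc m n = begin
  sum (map g (upTo (suc (suc n))))              ≡⟨ cong (λ ks → sum (map g ks)) (sym (upTo-∷ʳ (suc n))) ⟩
  sum (map g (upTo (suc n) ++ [ suc n ]))       ≡⟨ cong sum (map-++ g (upTo (suc n)) [ suc n ]) ⟩
  sum (map g (upTo (suc n)) ++ [ g (suc n) ])   ≡⟨ sum-++ (map g (upTo (suc n))) [ g (suc n) ] ⟩
  powerSum m n + (g (suc n) + 0)                ≡⟨ cong (powerSum m n +_) (+-identityʳ (g (suc n))) ⟩
  powerSum m n + g (suc n)                      ∎
  where
  open ≡-Reasoning
  g : ℕ → ℕ
  g k = suc k ^ m

length-admissibles : ∀ m n → length (admissibles m n) ≡ powerSum m n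
length-admissibles m zero    = sym (trans (+-identityʳ (1 ^ m)) (^-zeroˡ m))
length-admissibles m (suc n) = begin
  length (map (replicate (suc m) true ∷ᵛ_) (admissibles m n) ++ map _ (descendingMatrices (suc n) m))
    ≡⟨ length-++ (map (replicate (suc m) true ∷ᵛ_) (admissibles m n)) ⟩
  length (map _ (admissibles m n)) + length (map _ (descendingMatrices (suc n) m))
    ≡⟨ cong₂ _+_ (length-map _ (admissibles m n)) (length-map _ (descendingMatrices (suc n) m)) ⟩
  length (admissibles m n) + length (descendingMatrices (suc n) m)
    ≡⟨ cong₂ _+_ (length-admissibles m n) (length-descendingMatrices (suc n) m) ⟩
  powerSum m n + suc (suc n) ^ m
    ≡⟨ sym (powerSum-suc m n) ⟩
  powerSum m (suc n) ∎
  where open ≡-Reasoning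

proposition5p4 : (m n : ℕ) → 1 ≤ m →
    Σ (List (RelCS m n)) (λ L →
      Unique L ×
      ((T : RelCS m n) → (T ∈ L) ⇔ IsProperMerging (emptySC {m} {n}) T) ×
      (length L ≡ powerSum m n))
proposition5p4 m n _ =
  let unique , member = enum-admissibles m n
  in admissibles m n ,
     unique ,
     (λ T → ⇔.trans (member T) (⇔.sym (properMerging⇔admissible T))) ,
     length-admissibles m n
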